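{- Fix nonnegative integers $k,\ell$, not both zero. Then, as $n\to\infty$, \[\max_{\lambda\in H(k,\ell;n)} h_{1,1}(\lambda)\,r_\lambda\in\Theta\big(n^{k+\ell+1}\big).\]
   Context: $H(k,\ell;n)=\{\lambda\vdash n:\lambda_{k+1}\le\ell\}$ is the set of partitions of $n$ whose Young diagram lies in the $(k,\ell)$ hook $\{(i,j): i\le k\text{ or } j\le\ell\}$. $h_{1,1}(\lambda)=\lambda_1+\lambda'_1-1$, where $\lambda'_1$ is the number of parts of $\lambda$. $r_\lambda$ is the number of partitions $\alpha$ (including the empty one) whose Young diagram is contained in that of $\lambda$. The implied constants depend on $k,\ell$ only. -}

module Defs where

open import Data.Nat using (ℕ; zero; suc; _+_; _*_; _∸_; _≤_; _<_; _≥_; _≥?_)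
open import Data.Nat.ListAction using (sum)
open import Relation.Binary.PropositionalEquality using (_≡_)
open import Data.List using (List; []; _∷_; length; map; concatMap; upTo; filter)
open import Data.List.Relation.Unary.All using (All)
open import Data.List.Relation.Unary.Linked using (Linked; linked?)
open import Data.Product using (_×_)

IsPartition : ℕ → List ℕ → Set
IsPartition n μ = All (λ x → 0 < x) μ × Linked _≥_ μ × sum μ ≡ n

-- i-th part, 0-indexed (so part μ k = λ_{k+1}); 0 beyond the last part.
part : List ℕ → ℕ → ℕ
part []      _       = 0
part (x ∷ _) zero    = x
part (_ ∷ xs) (suc i) = part xs i

InH : ℕ → ℕ → ℕ → List ℕ → Set
InH k ℓ n μ = IsPartition n μ × part μ k ≤ ℓ

-- h_{1,1}(λ) = λ₁ + λ'₁ - 1  (λ'₁ = number of parts).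
h11 : List ℕ → ℕ
h11 μ = part μ 0 + length μ ∸ 1

boxes : List ℕ → List (List ℕ)
boxes []       = [] ∷ []
boxes (x ∷ xs) = concatMap (λ a → map (a ∷_) (boxes xs)) (upTo (suc x))

-- r_λ: number of partitions α (including the empty one) with α ⊆ λ.
-- Such α correspond bijectively (pad with zeros up to the length of λ)
-- to weakly decreasing sequences (a₁,…,a_m) with 0 ≤ aᵢ ≤ λᵢ.
r : List ℕ → ℕ
r μ = length (filter (linked? (λ a b → a ≥? b)) (boxes μ))

{-# OPTIONS --safe #-}
module Submission where

-- The number r λ of partitions α ⊆ λ is computed row by row: once α₁ = b is fixed, the remaining
-- rows form a partition inside λ₂, λ₃, … with first part ≤ b.
--
-- Upper bound: for λ ∈ H(k,ℓ;n) each of the first k rows of α has at most n + 1 choices, and the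
-- remaining rows of α lie in the first ℓ columns and at most n rows, which leaves
-- C(n + ℓ, ℓ) ≤ (n + 1)^ℓ choices; with h₁₁(λ) ≤ 2n this gives h₁₁(λ) r λ ≤ (2n)^(k+ℓ+1).
--
-- Lower bound: for q = ⌊n / ((k+ℓ)² + 1)⌋ take k rows of length kq + ℓ followed by ℓq rows of
-- length ℓ, the surplus going into the first row (or, if k = 0, into rows of length 1).
-- Choosing the first k rows of α in [ℓ, kq + ℓ] and the others inside the ℓq rows of length ℓ gives
-- r λ ≥ C(kq + k, k) · C(ℓq + ℓ, ℓ) ≥ (q + 1)^(k+ℓ), while h₁₁(λ) ≥ q and n ≤ 2((k+ℓ)² + 1) q.

open import Defs
open import Data.Nat using (ℕ; zero; suc; _+_; _*_; _∸_; _^_; _⊓_; _≤_; _<_; _≥_; _≥?_; z≤n; s≤s; z<s)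
open import Data.Nat.Properties
open import Data.Nat.DivMod using (_/_; _%_; m≡m%n+[m/n]*n; m%n≤n; m/n*n≤m; m≥n⇒m/n>0)
open import Data.Nat.ListAction using (sum)
open import Data.Nat.ListAction.Properties using (sum-++)
open import Data.Nat.Tactic.RingSolver using (solve-∀)
open import Data.List using (List; []; _∷_; [_]; _++_; _∷ʳ_; length; map; concatMap; upTo; filter; replicate)
open import Data.List.Properties using (length-++; length-replicate; map-++; map-concatMap; filter-++; upTo-∷ʳ)
open import Data.List.Relation.Unary.All as All using (All; []; _∷_)
open import Data.List.Relation.Unary.All.Properties using (++⁺; replicate⁺)
open import Data.List.Relation.Unary.Linked using (Linked; linked?; []; [-]; _∷_; tail)
open import Data.Empty using (⊥-elim)
open import Data.Product using (_×_; _,_; Σ-syntax; ∃-syntax)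
open import Data.Sum using (inj₁; inj₂)
open import Function using (_∘_)
open import Relation.Nullary using (¬_; yes; no)
open import Relation.Unary using (Decidable)
open import Relation.Binary.PropositionalEquality
  using (_≡_; refl; sym; trans; cong; cong₂; module ≡-Reasoning)

^-distribʳ-* : ∀ m n o → (m * n) ^ o ≡ m ^ o * n ^ o
^-distribʳ-* m n zero    = refl
^-distribʳ-* m n (suc o) = trans (cong (m * n *_) (^-distribʳ-* m n o)) (interchange m n (m ^ o) (n ^ o))
  where
  interchange : ∀ a b x y → a * b * (x * y) ≡ a * x * (b * y)
  interchange = solve-∀

∑≤ : ℕ → (ℕ → ℕ) → ℕ
∑≤ zero    g = g 0
∑≤ (suc y) g = ∑≤ y g + g (suc y)

syntax ∑≤ y (λ b → e) = ∑[ b ≤ y ] e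

∑-cong : ∀ y {f g : ℕ → ℕ} → (∀ {b} → b ≤ y → f b ≡ g b) → ∑≤ y f ≡ ∑≤ y g
∑-cong zero    f≡g = f≡g z≤n
∑-cong (suc y) f≡g = cong₂ _+_ (∑-cong y (f≡g ∘ m≤n⇒m≤1+n)) (f≡g ≤-refl)

∑-monoʳ-≤ : ∀ y {f g : ℕ → ℕ} → (∀ {b} → b ≤ y → f b ≤ g b) → ∑≤ y f ≤ ∑≤ y g
∑-monoʳ-≤ zero    f≤g = f≤g z≤n
∑-monoʳ-≤ (suc y) f≤g = +-mono-≤ (∑-monoʳ-≤ y (f≤g ∘ m≤n⇒m≤1+n)) (f≤g ≤-refl)

∑-monoˡ-≤ : ∀ {y z} g → y ≤ z → ∑≤ y g ≤ ∑≤ z g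
∑-monoˡ-≤ {z = zero}  g z≤n   = ≤-refl
∑-monoˡ-≤ {z = suc z} g y≤1+z with m≤n⇒m<n∨m≡n y≤1+z
... | inj₁ (s≤s y≤z) = ≤-trans (∑-monoˡ-≤ g y≤z) (m≤m+n _ _)
... | inj₂ refl      = ≤-refl

last-≤-∑ : ∀ y g → g y ≤ ∑≤ y g
last-≤-∑ zero    g = ≤-refl
last-≤-∑ (suc y) g = m≤n+m _ _

∑-truncate : ∀ {y z} {f : ℕ → ℕ} → y ≤ z → (∀ {b} → y < b → f b ≡ 0) → ∑≤ z f ≡ ∑≤ y f
∑-truncate {z = zero}  z≤n   _   = refl
∑-truncate {z = suc z} y≤1+z f≡0 with m≤n⇒m<n∨m≡n y≤1+z
... | inj₁ (s≤s y≤z) = trans (cong₂ _+_ (∑-truncate y≤z f≡0) (f≡0 (s≤s y≤z))) (+-identityʳ _)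
... | inj₂ refl      = refl

∑-⊓ : ∀ a y {f g : ℕ → ℕ} → (∀ {b} → b ≤ a → f b ≡ g b) → (∀ {b} → a < b → f b ≡ 0) →
      ∑≤ y f ≡ ∑≤ (a ⊓ y) g
∑-⊓ a y {f} {g} f≡g f≡0 with ≤-total a y
... | inj₁ a≤y = begin
  ∑≤ y f       ≡⟨ ∑-truncate a≤y f≡0 ⟩
  ∑≤ a f       ≡⟨ ∑-cong a f≡g ⟩
  ∑≤ a g       ≡⟨ cong (λ m → ∑≤ m g) (m≤n⇒m⊓n≡m a≤y) ⟨
  ∑≤ (a ⊓ y) g ∎
  where open ≡-Reasoning
... | inj₂ y≤a = begin
  ∑≤ y f       ≡⟨ ∑-cong y (λ b≤y → f≡g (≤-trans b≤y y≤a)) ⟩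
  ∑≤ y g       ≡⟨ cong (λ m → ∑≤ m g) (m≥n⇒m⊓n≡n y≤a) ⟨
  ∑≤ (a ⊓ y) g ∎
  where open ≡-Reasoning

∑-const : ∀ y x → ∑[ _ ≤ y ] x ≡ suc y * x
∑-const zero    x = sym (+-identityʳ x)
∑-const (suc y) x = trans (cong (_+ x) (∑-const y x)) (+-comm (suc y * x) x)

∑-distribʳ-* : ∀ y g x → ∑≤ y g * x ≡ ∑[ b ≤ y ] (g b * x)
∑-distribʳ-* zero    g x = refl
∑-distribʳ-* (suc y) g x =
  trans (*-distribʳ-+ x (∑≤ y g) (g (suc y))) (cong (_+ g (suc y) * x) (∑-distribʳ-* y g x))

∑-shift : ∀ d m g → ∑[ e ≤ d ] g (e + m) ≤ ∑≤ (d + m) g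
∑-shift zero    m g = last-≤-∑ m g
∑-shift (suc d) m g = +-monoˡ-≤ (g (suc (d + m))) (∑-shift d m g)

sum-map-upTo : ∀ g y → sum (map g (upTo (suc y))) ≡ ∑≤ y g
sum-map-upTo g zero    = +-identityʳ (g 0)
sum-map-upTo g (suc y) = begin
  sum (map g (upTo (suc (suc y))))              ≡⟨ cong (sum ∘ map g) (upTo-∷ʳ (suc y)) ⟨
  sum (map g (upTo (suc y) ∷ʳ suc y))           ≡⟨ cong sum (map-++ g (upTo (suc y)) [ suc y ]) ⟩
  sum (map g (upTo (suc y)) ++ [ g (suc y) ])   ≡⟨ sum-++ (map g (upTo (suc y))) [ g (suc y) ] ⟩
  sum (map g (upTo (suc y))) + (g (suc y) + 0)  ≡⟨ cong₂ _+_ (sum-map-upTo g y) (+-identityʳ _) ⟩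
  ∑≤ (suc y) g                                  ∎
  where open ≡-Reasoning

decreasing? : Decidable (Linked _≥_)
decreasing? = linked? (λ a b → a ≥? b)

#decreasing : List (List ℕ) → ℕ
#decreasing xss = length (filter decreasing? xss)

#decreasing-++ : ∀ xss yss → #decreasing (xss ++ yss) ≡ #decreasing xss + #decreasing yss
#decreasing-++ xss yss =
  trans (cong length (filter-++ decreasing? xss yss)) (length-++ (filter decreasing? xss))

#decreasing-concatMap : ∀ (g : ℕ → List (List ℕ)) xs →
                        #decreasing (concatMap g xs) ≡ sum (map (#decreasing ∘ g) xs)
#decreasing-concatMap g []       = refl
#decreasing-concatMap g (x ∷ xs) =
  trans (#decreasing-++ (g x) (concatMap g xs)) (cong (#decreasing (g x) +_) (#decreasing-concatMap g xs))

#decreasing-∷-cong : ∀ {xs ys xss yss} → (Linked _≥_ xs → Linked _≥_ ys) → (Linked _≥_ ys → Linked _≥_ xs) →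
                     #decreasing xss ≡ #decreasing yss → #decreasing (xs ∷ xss) ≡ #decreasing (ys ∷ yss)
#decreasing-∷-cong {xs} {ys} to from eq with decreasing? xs | decreasing? ys
... | yes _   | yes _   = cong suc eq
... | no _    | no _    = eq
... | yes xs↓ | no ¬ys↓ = ⊥-elim (¬ys↓ (to xs↓))
... | no ¬xs↓ | yes ys↓ = ⊥-elim (¬xs↓ (from ys↓))

#decreasing-∷-reject : ∀ {xs xss} → ¬ Linked _≥_ xs → #decreasing (xs ∷ xss) ≡ #decreasing xss
#decreasing-∷-reject {xs} ¬xs↓ with decreasing? xs
... | yes xs↓ = ⊥-elim (¬xs↓ xs↓)
... | no _    = refl

#decreasing-∷-∷ : ∀ {a b} → b ≤ a → ∀ ls →
                  #decreasing (map (a ∷_) (map (b ∷_) ls)) ≡ #decreasing (map (b ∷_) ls)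
#decreasing-∷-∷ b≤a []       = refl
#decreasing-∷-∷ b≤a (l ∷ ls) = #decreasing-∷-cong tail (b≤a ∷_) (#decreasing-∷-∷ b≤a ls)

#decreasing-∷-∷-> : ∀ {a b} → a < b → ∀ ls → #decreasing (map (a ∷_) (map (b ∷_) ls)) ≡ 0
#decreasing-∷-∷-> a<b []       = refl
#decreasing-∷-∷-> {a} {b} a<b (l ∷ ls) =
  trans (#decreasing-∷-reject {a ∷ b ∷ l} (λ { (b≤a ∷ _) → <⇒≱ a<b b≤a })) (#decreasing-∷-∷-> a<b ls)

-- r≤ a μ counts the partitions α ⊆ μ with α₁ ≤ a.
r≤ : ℕ → List ℕ → ℕ
r≤ a []       = 1
r≤ a (y ∷ ys) = ∑[ b ≤ a ⊓ y ] r≤ b ys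

#decreasing-∷-boxes : ∀ a μ → #decreasing (map (a ∷_) (boxes μ)) ≡ r≤ a μ
#decreasing-∷-boxes a []       = refl
#decreasing-∷-boxes a (y ∷ ys) = begin
  #decreasing (map (a ∷_) (concatMap rows (upTo (suc y))))
    ≡⟨ cong #decreasing (map-concatMap (a ∷_) rows (upTo (suc y))) ⟩
  #decreasing (concatMap (map (a ∷_) ∘ rows) (upTo (suc y)))
    ≡⟨ #decreasing-concatMap (map (a ∷_) ∘ rows) (upTo (suc y)) ⟩
  sum (map (#decreasing ∘ map (a ∷_) ∘ rows) (upTo (suc y)))
    ≡⟨ sum-map-upTo (#decreasing ∘ map (a ∷_) ∘ rows) y ⟩
  ∑[ b ≤ y ] #decreasing (map (a ∷_) (rows b))
    ≡⟨ ∑-⊓ a y (λ {b} b≤a → trans (#decreasing-∷-∷ b≤a (boxes ys)) (#decreasing-∷-boxes b ys))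
               (λ a<b → #decreasing-∷-∷-> a<b (boxes ys)) ⟩
  r≤ a (y ∷ ys) ∎
  where
  open ≡-Reasoning
  rows : ℕ → List (List ℕ)
  rows b = map (b ∷_) (boxes ys)

r≡r≤ : ∀ μ → r μ ≡ r≤ (part μ 0) μ
r≡r≤ []       = refl
r≡r≤ (y ∷ ys) = begin
  #decreasing (concatMap rows (upTo (suc y)))       ≡⟨ #decreasing-concatMap rows (upTo (suc y)) ⟩
  sum (map (#decreasing ∘ rows) (upTo (suc y)))     ≡⟨ sum-map-upTo (#decreasing ∘ rows) y ⟩
  ∑[ b ≤ y ] #decreasing (rows b)                   ≡⟨ ∑-cong y (λ {b} _ → #decreasing-∷-boxes b ys) ⟩
  ∑[ b ≤ y ] r≤ b ys                                ≡⟨ cong (λ m → ∑[ b ≤ m ] r≤ b ys) (⊓-idem y) ⟨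
  r≤ y (y ∷ ys)                                     ∎
  where
  open ≡-Reasoning
  rows : ℕ → List (List ℕ)
  rows b = map (b ∷_) (boxes ys)

r≤-mono-≤ : ∀ {a a′ y y′} → a ≤ a′ → y ≤ y′ → ∀ ys → r≤ a (y ∷ ys) ≤ r≤ a′ (y′ ∷ ys)
r≤-mono-≤ a≤a′ y≤y′ ys = ∑-monoˡ-≤ (λ b → r≤ b ys) (⊓-mono-≤ a≤a′ y≤y′)

r≤-monoˡ-≤ : ∀ {a a′} → a ≤ a′ → ∀ μ → r≤ a μ ≤ r≤ a′ μ
r≤-monoˡ-≤ a≤a′ []       = ≤-refl
r≤-monoˡ-≤ a≤a′ (y ∷ ys) = r≤-mono-≤ a≤a′ ≤-refl ys

r≤-positive : ∀ a μ → 0 < r≤ a μ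
r≤-positive a []       = z<s
r≤-positive a (y ∷ ys) = ≤-trans (r≤-positive 0 ys) (∑-monoˡ-≤ (λ b → r≤ b ys) (z≤n {a ⊓ y}))

r≤-≤-r : ∀ a μ → r≤ a μ ≤ r μ
r≤-≤-r a []       = ≤-refl
r≤-≤-r a (y ∷ ys) = begin
  r≤ a (y ∷ ys)  ≤⟨ ∑-monoˡ-≤ (λ b → r≤ b ys) (≤-trans (m⊓n≤n a y) (≤-reflexive (sym (⊓-idem y)))) ⟩
  r≤ y (y ∷ ys)  ≡⟨ r≡r≤ (y ∷ ys) ⟨
  r (y ∷ ys)     ∎
  where open ≤-Reasoning

r≤-++ʳ : ∀ a xs ys → r≤ a xs ≤ r≤ a (xs ++ ys)
r≤-++ʳ a []       ys = r≤-positive a ys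
r≤-++ʳ a (x ∷ xs) ys = ∑-monoʳ-≤ (a ⊓ x) (λ {b} _ → r≤-++ʳ b xs ys)

r≤-∷-≤ : ∀ a y ys → r≤ a (y ∷ ys) ≤ suc y * r≤ a ys
r≤-∷-≤ a y ys = begin
  ∑[ b ≤ a ⊓ y ] r≤ b ys  ≤⟨ ∑-monoʳ-≤ (a ⊓ y) (λ b≤a⊓y → r≤-monoˡ-≤ (≤-trans b≤a⊓y (m⊓n≤m a y)) ys) ⟩
  ∑[ _ ≤ a ⊓ y ] r≤ a ys  ≡⟨ ∑-const (a ⊓ y) (r≤ a ys) ⟩
  suc (a ⊓ y) * r≤ a ys   ≤⟨ *-monoˡ-≤ (r≤ a ys) (s≤s (m⊓n≤n a y)) ⟩
  suc y * r≤ a ys         ∎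
  where open ≤-Reasoning

-- multichoose a m = C(a + m, m), the number of weakly decreasing sequences of length m with entries ≤ a.
multichoose : ℕ → ℕ → ℕ
multichoose a zero    = 1
multichoose a (suc m) = ∑[ b ≤ a ] multichoose b m

multichoose-monoˡ-≤ : ∀ {a a′} m → a ≤ a′ → multichoose a m ≤ multichoose a′ m
multichoose-monoˡ-≤ zero    _    = ≤-refl
multichoose-monoˡ-≤ (suc m) a≤a′ = ∑-monoˡ-≤ (λ b → multichoose b m) a≤a′

multichoose-zeroˡ : ∀ m → multichoose 0 m ≡ 1
multichoose-zeroˡ zero    = refl
multichoose-zeroˡ (suc m) = multichoose-zeroˡ m

multichoose-comm : ∀ a m → multichoose a m ≡ multichoose m a
multichoose-comm zero    m       = multichoose-zeroˡ m
multichoose-comm (suc a) zero    = sym (multichoose-zeroˡ (suc a))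
multichoose-comm (suc a) (suc m) = begin
  multichoose a (suc m) + multichoose (suc a) m
    ≡⟨ cong₂ _+_ (multichoose-comm a (suc m)) (multichoose-comm (suc a) m) ⟩
  multichoose (suc m) a + multichoose m (suc a)
    ≡⟨ +-comm (multichoose (suc m) a) (multichoose m (suc a)) ⟩
  multichoose m (suc a) + multichoose (suc m) a ∎
  where open ≡-Reasoning

multichoose-≤-^ : ∀ a m → multichoose a m ≤ suc a ^ m
multichoose-≤-^ a zero    = ≤-refl
multichoose-≤-^ a (suc m) = begin
  ∑[ b ≤ a ] multichoose b m  ≤⟨ ∑-monoʳ-≤ a (λ b≤a → multichoose-monoˡ-≤ m b≤a) ⟩
  ∑[ _ ≤ a ] multichoose a m  ≡⟨ ∑-const a (multichoose a m) ⟩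
  suc a * multichoose a m     ≤⟨ *-monoʳ-≤ (suc a) (multichoose-≤-^ a m) ⟩
  suc a * suc a ^ m           ∎
  where open ≤-Reasoning

^-≤-multichoose : ∀ m q {a} → m * q ≤ a → suc q ^ m ≤ multichoose a m
^-≤-multichoose zero    q _          = ≤-refl
^-≤-multichoose (suc m) q {a} mq≤a = begin
  suc q * suc q ^ m                     ≤⟨ *-monoʳ-≤ (suc q) (^-≤-multichoose m q ≤-refl) ⟩
  suc q * multichoose (m * q) m         ≡⟨ ∑-const q (multichoose (m * q) m) ⟨
  ∑[ _ ≤ q ] multichoose (m * q) m      ≤⟨ ∑-monoʳ-≤ q (λ {e} _ → multichoose-monoˡ-≤ m (m≤n+m (m * q) e)) ⟩
  ∑[ e ≤ q ] multichoose (e + m * q) m  ≤⟨ ∑-shift q (m * q) (λ b → multichoose b m) ⟩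
  ∑[ b ≤ q + m * q ] multichoose b m    ≤⟨ ∑-monoˡ-≤ (λ b → multichoose b m) mq≤a ⟩
  ∑[ b ≤ a ] multichoose b m            ∎
  where open ≤-Reasoning

r≤-≤-multichoose : ∀ a μ → r≤ a μ ≤ multichoose a (length μ)
r≤-≤-multichoose a []       = ≤-refl
r≤-≤-multichoose a (y ∷ ys) = begin
  ∑[ b ≤ a ⊓ y ] r≤ b ys                    ≤⟨ ∑-monoʳ-≤ (a ⊓ y) (λ {b} _ → r≤-≤-multichoose b ys) ⟩
  ∑[ b ≤ a ⊓ y ] multichoose b (length ys)  ≤⟨ ∑-monoˡ-≤ (λ b → multichoose b (length ys)) (m⊓n≤m a y) ⟩
  multichoose a (suc (length ys))           ∎
  where open ≤-Reasoning

multichoose-≤-r≤-replicate : ∀ {a c} → a ≤ c → ∀ m → multichoose a m ≤ r≤ a (replicate m c)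
multichoose-≤-r≤-replicate a≤c zero    = ≤-refl
multichoose-≤-r≤-replicate {a} {c} a≤c (suc m) = begin
  ∑[ b ≤ a ] multichoose b m       ≤⟨ ∑-monoʳ-≤ a (λ b≤a → multichoose-≤-r≤-replicate (≤-trans b≤a a≤c) m) ⟩
  ∑[ b ≤ a ] r≤ b (replicate m c)  ≡⟨ cong (λ x → ∑[ b ≤ x ] r≤ b (replicate m c)) (m≤n⇒m⊓n≡m a≤c) ⟨
  r≤ a (replicate (suc m) c)       ∎
  where open ≤-Reasoning

^-≤-r≤-replicate : ∀ ℓ q → suc q ^ ℓ ≤ r≤ ℓ (replicate (ℓ * q) ℓ)
^-≤-r≤-replicate ℓ q = begin
  suc q ^ ℓ                   ≤⟨ ^-≤-multichoose ℓ q ≤-refl ⟩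
  multichoose (ℓ * q) ℓ       ≡⟨ multichoose-comm (ℓ * q) ℓ ⟩
  multichoose ℓ (ℓ * q)       ≤⟨ multichoose-≤-r≤-replicate ≤-refl (ℓ * q) ⟩
  r≤ ℓ (replicate (ℓ * q) ℓ)  ∎
  where open ≤-Reasoning

multichoose-*-≤-r≤-replicate-++ : ∀ ℓ k A {d} T → d ≤ A →
  multichoose d k * r≤ ℓ T ≤ r≤ (d + ℓ) (replicate k (A + ℓ) ++ T)
multichoose-*-≤-r≤-replicate-++ ℓ zero A {d} T _ = begin
  1 * r≤ ℓ T    ≡⟨ *-identityˡ (r≤ ℓ T) ⟩
  r≤ ℓ T        ≤⟨ r≤-monoˡ-≤ (m≤n+m ℓ d) T ⟩
  r≤ (d + ℓ) T  ∎
  where open ≤-Reasoning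
multichoose-*-≤-r≤-replicate-++ ℓ (suc k) A {d} T d≤A = begin
  (∑[ e ≤ d ] multichoose e k) * r≤ ℓ T  ≡⟨ ∑-distribʳ-* d (λ e → multichoose e k) (r≤ ℓ T) ⟩
  ∑[ e ≤ d ] (multichoose e k * r≤ ℓ T)  ≤⟨ ∑-monoʳ-≤ d (λ e≤d → rest-bound (≤-trans e≤d d≤A)) ⟩
  ∑[ e ≤ d ] r≤ (e + ℓ) rows             ≤⟨ ∑-shift d ℓ (λ b → r≤ b rows) ⟩
  ∑[ b ≤ d + ℓ ] r≤ b rows               ≡⟨ cong (λ x → ∑[ b ≤ x ] r≤ b rows) (m≤n⇒m⊓n≡m (+-monoˡ-≤ ℓ d≤A)) ⟨
  r≤ (d + ℓ) ((A + ℓ) ∷ rows)            ∎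
  where
  open ≤-Reasoning
  rows = replicate k (A + ℓ) ++ T
  rest-bound : ∀ {e} → e ≤ A → multichoose e k * r≤ ℓ T ≤ r≤ (e + ℓ) rows
  rest-bound = multichoose-*-≤-r≤-replicate-++ ℓ k A T

∷-decreasing : ∀ {x ys} → All (_≤ x) ys → Linked _≥_ ys → Linked _≥_ (x ∷ ys)
∷-decreasing []        []  = [-]
∷-decreasing (y≤x ∷ _) ys↓ = y≤x ∷ ys↓

replicate-decreasing : ∀ m {c} → Linked _≥_ (replicate m c)
replicate-decreasing zero          = []
replicate-decreasing (suc zero)    = [-]
replicate-decreasing (suc (suc m)) = ≤-refl ∷ replicate-decreasing (suc m)

replicate-++-decreasing : ∀ m {c ys} → All (_≤ c) ys → Linked _≥_ ys → Linked _≥_ (replicate m c ++ ys)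
replicate-++-decreasing zero    _    ys↓ = ys↓
replicate-++-decreasing (suc m) ys≤c ys↓ =
  ∷-decreasing (++⁺ (replicate⁺ m ≤-refl) ys≤c) (replicate-++-decreasing m ys≤c ys↓)

replicate-*-positive : ∀ ℓ q → All (0 <_) (replicate (ℓ * q) ℓ)
replicate-*-positive zero    q = []
replicate-*-positive (suc ℓ) q = replicate⁺ (suc ℓ * q) z<s

sum-replicate : ∀ m x → sum (replicate m x) ≡ m * x
sum-replicate zero    x = refl
sum-replicate (suc m) x = cong (x +_) (sum-replicate m x)

all-≤-sum : ∀ μ → All (_≤ sum μ) μ
all-≤-sum []       = []
all-≤-sum (y ∷ ys) = m≤m+n y (sum ys) ∷ All.map (λ z≤s → ≤-trans z≤s (m≤n+m (sum ys) y)) (all-≤-sum ys)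

length-≤-sum : ∀ {μ} → All (0 <_) μ → length μ ≤ sum μ
length-≤-sum []           = z≤n
length-≤-sum (0<y ∷ 0<ys) = +-mono-≤ 0<y (length-≤-sum 0<ys)

part-replicate-++ : ∀ m {c} ys → part (replicate m c ++ ys) m ≡ part ys 0
part-replicate-++ zero    ys = refl
part-replicate-++ (suc m) ys = part-replicate-++ m ys

part-≤ : ∀ {x μ} → All (_≤ x) μ → ∀ i → part μ i ≤ x
part-≤ []        i       = z≤n
part-≤ (y≤x ∷ _) zero    = y≤x
part-≤ (_ ∷ μ≤x) (suc i) = part-≤ μ≤x i

h11-∷ : ∀ x xs → h11 (x ∷ xs) ≡ x + length xs
h11-∷ x xs = cong (_∸ 1) (+-suc x (length xs))

length-≤-h11 : ∀ {μ} → All (0 <_) μ → length μ ≤ h11 μ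
length-≤-h11 []                 = z≤n
length-≤-h11 {x ∷ xs} (0<x ∷ _) = ≤-trans (+-monoˡ-≤ (length xs) 0<x) (≤-reflexive (sym (h11-∷ x xs)))

h11-≤-2*sum : ∀ {μ} → All (0 <_) μ → h11 μ ≤ 2 * sum μ
h11-≤-2*sum {μ} positive = begin
  part μ 0 + length μ ∸ 1  ≤⟨ m∸n≤m _ 1 ⟩
  part μ 0 + length μ      ≤⟨ +-mono-≤ (part-≤ (all-≤-sum μ) 0) (length-≤-sum positive) ⟩
  sum μ + sum μ            ≡⟨ cong (sum μ +_) (+-identityʳ (sum μ)) ⟨
  2 * sum μ                ∎
  where open ≤-Reasoning

r≤-≤-^ : ∀ k {ℓ n} a μ → part μ k ≤ ℓ → All (_≤ n) μ → length μ ≤ n → r≤ a μ ≤ suc n ^ (k + ℓ)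
r≤-≤-^ zero {ℓ} {n} a μ μ₁≤ℓ _ len≤n = begin
  r≤ a μ                             ≤⟨ r≤-≤-r a μ ⟩
  r μ                                ≡⟨ r≡r≤ μ ⟩
  r≤ (part μ 0) μ                    ≤⟨ r≤-≤-multichoose (part μ 0) μ ⟩
  multichoose (part μ 0) (length μ)  ≤⟨ multichoose-monoˡ-≤ (length μ) μ₁≤ℓ ⟩
  multichoose ℓ (length μ)           ≡⟨ multichoose-comm ℓ (length μ) ⟩
  multichoose (length μ) ℓ           ≤⟨ multichoose-≤-^ (length μ) ℓ ⟩
  suc (length μ) ^ ℓ                 ≤⟨ ^-monoˡ-≤ ℓ (s≤s len≤n) ⟩
  suc n ^ ℓ                          ∎
  where open ≤-Reasoning
r≤-≤-^ (suc k) {ℓ} {n} a []       _    _            _     = m^n>0 (suc n) (suc k + ℓ)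
r≤-≤-^ (suc k) {ℓ} {n} a (y ∷ ys) hook (y≤n ∷ ys≤n) len≤n = begin
  r≤ a (y ∷ ys)            ≤⟨ r≤-∷-≤ a y ys ⟩
  suc y * r≤ a ys          ≤⟨ *-mono-≤ (s≤s y≤n) (r≤-≤-^ k a ys hook ys≤n (≤-trans (n≤1+n _) len≤n)) ⟩
  suc n * suc n ^ (k + ℓ)  ∎
  where open ≤-Reasoning

upper-bound : ∀ k ℓ {n} → 0 < n → ∀ μ → InH k ℓ n μ → h11 μ * r μ ≤ 2 ^ suc (k + ℓ) * n ^ suc (k + ℓ)
upper-bound k ℓ 0<n μ ((positive , _ , refl) , hook) = begin
  h11 μ * r μ                        ≤⟨ *-mono-≤ (h11-≤-2*sum positive) r-bound ⟩
  2 * n * suc n ^ (k + ℓ)            ≤⟨ *-monoʳ-≤ (2 * n) (^-monoˡ-≤ (k + ℓ) 1+n≤2*n) ⟩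
  (2 * n) ^ suc (k + ℓ)              ≡⟨ ^-distribʳ-* 2 n (suc (k + ℓ)) ⟩
  2 ^ suc (k + ℓ) * n ^ suc (k + ℓ)  ∎
  where
  open ≤-Reasoning
  n = sum μ
  1+n≤2*n : suc n ≤ 2 * n
  1+n≤2*n = ≤-trans (+-monoˡ-≤ n 0<n) (≤-reflexive (cong (n +_) (sym (+-identityʳ n))))
  r-bound : r μ ≤ suc n ^ (k + ℓ)
  r-bound = ≤-trans (≤-reflexive (r≡r≤ μ)) (r≤-≤-^ k (part μ 0) μ hook (all-≤-sum μ) (length-≤-sum positive))

Witness : ℕ → ℕ → ℕ → ℕ → Set
Witness k ℓ n q = Σ[ μ ∈ List ℕ ] (InH k ℓ n μ × q ≤ h11 μ × suc q ^ (k + ℓ) ≤ r μ)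

arm-witness : ∀ k′ ℓ {n q} → 0 < q → suc k′ * (suc k′ * q + ℓ) + ℓ * q * ℓ ≤ n → Witness (suc k′) ℓ n q
arm-witness k′ ℓ {n} {q} 0<q size≤n = μ , ((positive , decreasing , sum≡n) , hook) , q≤h11 , q^≤r
  where
  open ≤-Reasoning
  k = suc k′
  c = k * q + ℓ
  L = ℓ * q
  e = n ∸ (k * c + L * ℓ)
  ys = replicate k′ c ++ replicate L ℓ
  μ = (e + c) ∷ ys

  q≤c : q ≤ c
  q≤c = ≤-trans (m≤m+n q (k′ * q)) (m≤m+n (k * q) ℓ)
  ℓ≤c : ℓ ≤ c
  ℓ≤c = m≤n+m ℓ (k * q)
  c≤e+c : c ≤ e + c
  c≤e+c = m≤n+m c e

  positive : All (0 <_) μ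
  positive = ≤-trans 0<c c≤e+c ∷ ++⁺ (replicate⁺ k′ 0<c) (replicate-*-positive ℓ q)
    where 0<c = ≤-trans 0<q q≤c

  decreasing : Linked _≥_ μ
  decreasing = ∷-decreasing (++⁺ (replicate⁺ k′ c≤e+c) (replicate⁺ L (≤-trans ℓ≤c c≤e+c)))
                            (replicate-++-decreasing k′ (replicate⁺ L ℓ≤c) (replicate-decreasing L))

  sum≡n : sum μ ≡ n
  sum≡n = begin-equality
    e + c + sum ys              ≡⟨ cong (e + c +_) (sum-++ (replicate k′ c) (replicate L ℓ)) ⟩
    e + c + (sum (replicate k′ c) + sum (replicate L ℓ))
                                ≡⟨ cong (e + c +_) (cong₂ _+_ (sum-replicate k′ c) (sum-replicate L ℓ)) ⟩
    e + c + (k′ * c + L * ℓ)    ≡⟨ +-assoc e c _ ⟩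
    e + (c + (k′ * c + L * ℓ))  ≡⟨ cong (e +_) (+-assoc c (k′ * c) (L * ℓ)) ⟨
    e + (k * c + L * ℓ)         ≡⟨ +-comm e _ ⟩
    k * c + L * ℓ + e           ≡⟨ m+[n∸m]≡n size≤n ⟩
    n                           ∎

  hook : part μ k ≤ ℓ
  hook = ≤-trans (≤-reflexive (part-replicate-++ k′ (replicate L ℓ))) (part-≤ (replicate⁺ L ≤-refl) 0)

  q≤h11 : q ≤ h11 μ
  q≤h11 = begin
    q                  ≤⟨ ≤-trans q≤c c≤e+c ⟩
    e + c              ≤⟨ m≤m+n (e + c) (length ys) ⟩
    e + c + length ys  ≡⟨ h11-∷ (e + c) ys ⟨
    h11 μ              ∎

  q^≤r : suc q ^ (k + ℓ) ≤ r μ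
  q^≤r = begin
    suc q ^ (k + ℓ)
      ≡⟨ ^-distribˡ-+-* (suc q) k ℓ ⟩
    suc q ^ k * suc q ^ ℓ
      ≤⟨ *-mono-≤ (^-≤-multichoose k q ≤-refl) (^-≤-r≤-replicate ℓ q) ⟩
    multichoose (k * q) k * r≤ ℓ (replicate L ℓ)
      ≤⟨ multichoose-*-≤-r≤-replicate-++ ℓ k (k * q) (replicate L ℓ) ≤-refl ⟩
    r≤ c (c ∷ ys)
      ≤⟨ r≤-mono-≤ {a = c} ≤-refl c≤e+c ys ⟩
    r≤ c μ
      ≤⟨ r≤-≤-r c μ ⟩
    r μ ∎

leg-witness : ∀ ℓ′ {n q} → suc ℓ′ * q * suc ℓ′ ≤ n → Witness 0 (suc ℓ′) n q
leg-witness ℓ′ {n} {q} size≤n = μ , ((positive , decreasing , sum≡n) , part-≤ μ≤ℓ 0) , q≤h11 , q^≤r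
  where
  open ≤-Reasoning
  ℓ = suc ℓ′
  L = ℓ * q
  t = n ∸ L * ℓ
  μ = replicate L ℓ ++ replicate t 1

  μ≤ℓ : All (_≤ ℓ) μ
  μ≤ℓ = ++⁺ (replicate⁺ L ≤-refl) (replicate⁺ t (s≤s z≤n))

  positive : All (0 <_) μ
  positive = ++⁺ (replicate⁺ L z<s) (replicate⁺ t z<s)

  decreasing : Linked _≥_ μ
  decreasing = replicate-++-decreasing L (replicate⁺ t (s≤s z≤n)) (replicate-decreasing t)

  sum≡n : sum μ ≡ n
  sum≡n = begin-equality
    sum μ                                      ≡⟨ sum-++ (replicate L ℓ) (replicate t 1) ⟩
    sum (replicate L ℓ) + sum (replicate t 1)  ≡⟨ cong₂ _+_ (sum-replicate L ℓ) (sum-replicate t 1) ⟩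
    L * ℓ + t * 1                              ≡⟨ cong (L * ℓ +_) (*-identityʳ t) ⟩
    L * ℓ + t                                  ≡⟨ m+[n∸m]≡n size≤n ⟩
    n                                          ∎

  q≤h11 : q ≤ h11 μ
  q≤h11 = begin
    q                                                ≤⟨ m≤m+n q (ℓ′ * q) ⟩
    L                                                ≡⟨ length-replicate L ⟨
    length (replicate L ℓ)                           ≤⟨ m≤m+n _ (length (replicate t 1)) ⟩
    length (replicate L ℓ) + length (replicate t 1)  ≡⟨ length-++ (replicate L ℓ) ⟨
    length μ                                         ≤⟨ length-≤-h11 positive ⟩
    h11 μ                                            ∎

  q^≤r : suc q ^ ℓ ≤ r μ
  q^≤r = begin
    suc q ^ ℓ             ≤⟨ ^-≤-r≤-replicate ℓ q ⟩
    r≤ ℓ (replicate L ℓ)  ≤⟨ r≤-++ʳ ℓ (replicate L ℓ) (replicate t 1) ⟩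
    r≤ ℓ μ                ≤⟨ r≤-≤-r ℓ μ ⟩
    r μ                   ∎

witness : ∀ k ℓ {n q} → 0 < k + ℓ → 0 < q → k * (k * q + ℓ) + ℓ * q * ℓ ≤ n → Witness k ℓ n q
witness (suc k′) ℓ        _ 0<q size≤n = arm-witness k′ ℓ 0<q size≤n
witness zero     (suc ℓ′) _ _   size≤n = leg-witness ℓ′ size≤n

hook-size-≤ : ∀ k ℓ q → 0 < q → k * (k * q + ℓ) + ℓ * q * ℓ ≤ (k + ℓ) * (k + ℓ) * q
hook-size-≤ k ℓ (suc q′) _ = ≤-trans (m≤m+n _ (k * ℓ + 2 * k * ℓ * q′)) (≤-reflexive (expand k ℓ q′))
  where
  expand : ∀ k ℓ q′ → k * (k * (1 + q′) + ℓ) + ℓ * (1 + q′) * ℓ + (k * ℓ + 2 * k * ℓ * q′)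
                      ≡ (k + ℓ) * (k + ℓ) * (1 + q′)
  expand = solve-∀

scale : ℕ → ℕ → ℕ
scale k ℓ = suc ((k + ℓ) * (k + ℓ))

lower-bound : ∀ k ℓ → 0 < k + ℓ → ∀ {n} → scale k ℓ ≤ n →
  Σ[ μ ∈ List ℕ ] (InH k ℓ n μ × n ^ suc (k + ℓ) ≤ (2 * scale k ℓ) ^ suc (k + ℓ) * (h11 μ * r μ))
lower-bound k ℓ 0<k+ℓ {n} M≤n = conclude (witness k ℓ 0<k+ℓ 0<q size≤n)
  where
  open ≤-Reasoning
  K = k + ℓ
  M = scale k ℓ
  q = n / M

  0<q : 0 < q
  0<q = m≥n⇒m/n>0 M≤n

  size≤n : k * (k * q + ℓ) + ℓ * q * ℓ ≤ n
  size≤n = begin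
    k * (k * q + ℓ) + ℓ * q * ℓ  ≤⟨ hook-size-≤ k ℓ q 0<q ⟩
    K * K * q                    ≤⟨ m≤n+m _ q ⟩
    M * q                        ≡⟨ *-comm M q ⟩
    q * M                        ≤⟨ m/n*n≤m n M ⟩
    n                            ∎

  n≤2Mq : n ≤ 2 * M * q
  n≤2Mq = begin
    n              ≡⟨ m≡m%n+[m/n]*n n M ⟩
    n % M + q * M  ≤⟨ +-monoˡ-≤ (q * M) (m%n≤n n M) ⟩
    suc q * M      ≤⟨ *-monoˡ-≤ M (+-monoˡ-≤ q 0<q) ⟩
    (q + q) * M    ≡⟨ rearrange q M ⟩
    2 * M * q      ∎
    where
    rearrange : ∀ q M → (q + q) * M ≡ 2 * M * q
    rearrange = solve-∀

  conclude : Witness k ℓ n q →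
    Σ[ μ ∈ List ℕ ] (InH k ℓ n μ × n ^ suc K ≤ (2 * M) ^ suc K * (h11 μ * r μ))
  conclude (μ , μ∈H , q≤h11 , q^≤r) = μ , μ∈H , (begin
    n ^ suc K                        ≤⟨ ^-monoˡ-≤ (suc K) n≤2Mq ⟩
    (2 * M * q) ^ suc K              ≡⟨ ^-distribʳ-* (2 * M) q (suc K) ⟩
    (2 * M) ^ suc K * (q * q ^ K)    ≤⟨ *-monoʳ-≤ ((2 * M) ^ suc K) (*-mono-≤ q≤h11 q^K≤r) ⟩
    (2 * M) ^ suc K * (h11 μ * r μ)  ∎)
    where
    q^K≤r : q ^ K ≤ r μ
    q^K≤r = ≤-trans (^-monoˡ-≤ K (n≤1+n q)) q^≤r

proposition9 : (k ℓ : ℕ) → 0 < k + ℓ →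
    ∃[ c ] ∃[ C ] ∃[ N ] ((n : ℕ) → N ≤ n →
      (Σ[ μ ∈ List ℕ ] (InH k ℓ n μ × n ^ (k + ℓ + 1) ≤ c * (h11 μ * r μ)))
      × ((μ : List ℕ) → InH k ℓ n μ → h11 μ * r μ ≤ C * n ^ (k + ℓ + 1)))
proposition9 k ℓ 0<k+ℓ rewrite +-comm (k + ℓ) 1 =
  (2 * scale k ℓ) ^ suc (k + ℓ) , 2 ^ suc (k + ℓ) , scale k ℓ ,
  λ n M≤n → lower-bound k ℓ 0<k+ℓ M≤n , upper-bound k ℓ (≤-trans z<s M≤n)
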